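{- Let $k\geq 1$ and $d\geq 0$ be integers. For every $(k,d)$-shortcut system $\mathcal{P}$ of a graph $G$, the graph $G^{\mathcal{P}}$ is a $\frac{k-1}{2}$-shallow topological minor of $G\circ\overline{K_{d+1}}$.
   Context: All graphs are finite and simple. A set $\mathcal{P}$ of paths in $G$ is a $(k,d)$-shortcut system if every path in $\mathcal{P}$ has length at most $k$ and every vertex of $G$ is an internal vertex of at most $d$ paths in $\mathcal{P}$. $G^{\mathcal{P}}$ is the supergraph of $G$ obtained by adding the edge $uv$ whenever $\mathcal{P}$ contains a path with end-vertices $u$ and $v$. $\overline{K_{d+1}}$ is the edgeless graph on $d+1$ vertices; the lexicographic product $A\circ B$ has vertex set $V(A)\times V(B)$, with $(a,v)(b,u)$ an edge iff $ab\in E(A)$, or $a=b$ and $uv\in E(B)$. For a half-integer $s\geq 0$, $H$ is an $s$-shallow topological minor of $X$ if some subgraph of $X$ is isomorphic to a graph obtained from $H$ by replacing each edge $uv$ by a path with end-vertices $u,v$ of length at most $2s+1$ (paths internally disjoint, internal vertices new). -}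

module Defs where

open import Data.Nat using (ℕ; zero; suc; _≤_; _<_)
open import Data.Fin using (Fin; toℕ; fromℕ; inject₁)
import Data.Fin as F
open import Data.Product using (Σ; ∃; _×_; _,_; proj₁; proj₂)
open import Data.Sum using (_⊎_; inj₁; inj₂)
open import Data.Empty using (⊥)
open import Relation.Nullary using (¬_)
open import Relation.Binary.PropositionalEquality using (_≡_; _≢_; refl)
open import Function.Definitions using (Injective)

-- A (simple) graph on vertex type V: symmetric, irreflexive edge relation.
-- Graphs in the statement have vertex types Fin n (or products of such),
-- hence are finite.
record Graph (V : Set) : Set₁ where
  field
    E     : V → V → Set
    Esym   : ∀ {u v} → E u v → E v u
    Eirrefl : ∀ {v} → ¬ E v v
open Graph public

record Path {V : Set} (G : Graph V) : Set where
  field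
    len   : ℕ
    verts : Fin (suc len) → V
    distinct : Injective _≡_ _≡_ verts
    adjacent : ∀ (i : Fin len) → E G (verts (inject₁ i)) (verts (F.suc i))
open Path public

start : ∀ {V} {G : Graph V} → Path G → V
start p = verts p F.zero

end : ∀ {V} {G : Graph V} → Path G → V
end p = verts p (fromℕ (len p))

Internal : ∀ {V} {G : Graph V} → Path G → V → Set
Internal p v = Σ (Fin (suc (len p))) λ i →
  (0 < toℕ i) × (toℕ i < len p) × (verts p i ≡ v)

-- A (k,d)-shortcut system, given as a family of m paths indexed by Fin m.
-- "at most d paths have v as internal vertex": no d+1 distinct paths
-- of the family all have v as an internal vertex.
IsShortcutSystem : ∀ {V} (G : Graph V) (k d : ℕ) {m : ℕ} → (Fin m → Path G) → Set
IsShortcutSystem {V} G k d {m} P =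
  (∀ j → len (P j) ≤ k) ×
  (∀ (v : V) (f : Fin (suc d) → Fin m) → Injective _≡_ _≡_ f →
     (∀ i → Internal (P (f i)) v) → ⊥)

shortcutE : ∀ {V} (G : Graph V) {m : ℕ} → (Fin m → Path G) → V → V → Set
shortcutE G {m} P u v = E G u v ⊎
  ((u ≢ v) × Σ (Fin m) λ j →
     ((start (P j) ≡ u) × (end (P j) ≡ v)) ⊎ ((start (P j) ≡ v) × (end (P j) ≡ u)))

shortcutGraph : ∀ {V} (G : Graph V) {m : ℕ} → (Fin m → Path G) → Graph V
shortcutGraph G P = record { E = shortcutE G P ; Esym = s ; Eirrefl = i }
  where
  s : ∀ {u v} → shortcutE G P u v → shortcutE G P v u
  s (inj₁ e) = inj₁ (Esym G e)
  s (inj₂ (ne , j , inj₁ (a , b))) = inj₂ ((λ eq → ne (Relation.Binary.PropositionalEquality.sym eq)) , j , inj₂ (a , b))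
  s (inj₂ (ne , j , inj₂ (a , b))) = inj₂ ((λ eq → ne (Relation.Binary.PropositionalEquality.sym eq)) , j , inj₁ (a , b))
  i : ∀ {v} → ¬ shortcutE G P v v
  i (inj₁ e) = Eirrefl G e
  i (inj₂ (ne , _)) = ne refl

edgeless : (W : Set) → Graph W
edgeless W = record { E = λ _ _ → ⊥ ; Esym = λ () ; Eirrefl = λ () }

lexE : ∀ {V W} → Graph V → Graph W → V × W → V × W → Set
lexE A B (a , x) (b , y) = E A a b ⊎ ((a ≡ b) × E B x y)

lex : ∀ {V W} → Graph V → Graph W → Graph (V × W)
lex A B = record { E = lexE A B ; Esym = s ; Eirrefl = i }
  where
  s : ∀ {u v} → lexE A B u v → lexE A B v u
  s (inj₁ e) = inj₁ (Esym A e)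
  s (inj₂ (refl , e)) = inj₂ (refl , Esym B e)
  i : ∀ {v} → ¬ lexE A B v v
  i (inj₁ e) = Eirrefl A e
  i (inj₂ (_ , e)) = Eirrefl B e

-- H is an s-shallow topological minor of X, where t = 2s (so s may be a
-- half-integer): injective branch map φ, and for each edge uv of H (taken once,
-- with toℕ u < toℕ v) a path in X from φ u to φ v of length ≤ 2s+1 = t+1,
-- whose internal vertices are not branch vertices, and paths of distinct
-- edges are internally disjoint.
ShallowTopMinor2s : (t : ℕ) {h : ℕ} {W : Set} → Graph (Fin h) → Graph W → Set
ShallowTopMinor2s t {h} {W} H X =
  Σ (Fin h → W) λ φ →
  Injective _≡_ _≡_ φ ×
  Σ (∀ (u v : Fin h) → toℕ u < toℕ v → E H u v → Path X) λ Q →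
    (∀ u v (lt : toℕ u < toℕ v) (e : E H u v) →
        (start (Q u v lt e) ≡ φ u) × (end (Q u v lt e) ≡ φ v)
        × (len (Q u v lt e) ≤ suc t)
        × (∀ w z → Internal (Q u v lt e) z → φ w ≢ z)) ×
    (∀ u v (lt : toℕ u < toℕ v) (e : E H u v)
       u' v' (lt' : toℕ u' < toℕ v') (e' : E H u' v') →
       ¬ ((u ≡ u') × (v ≡ v')) →
       ∀ z → Internal (Q u v lt e) z → ¬ Internal (Q u' v' lt' e') z)

{-# OPTIONS --safe #-}
-- Take the copies (v , 0) of G ∘ K̄_{d+1} as branch vertices. An edge of G is
-- routed along itself; a shortcut P j is lifted copy by copy, its internal vertex w
-- being replaced by the copy (w , 1 + c), where c < d is the position of j among
-- the at most d paths of the system through w. Lifted paths thus avoid branch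
-- vertices, keep their length, and two of them sharing an internal vertex would
-- come from the same P j, which (as the endpoints are ordered) is the same edge of G^P.
module Submission where

open import Defs
open import Data.Nat using (ℕ; suc; _≤_; _∸_; _<_; z≤n; s≤s)
open import Data.Nat.Properties using (_<?_; <-irrefl; <-asym; <⇒≤; ≮⇒≥; m<n⇒0<n∸m; ∸-monoʳ-<)
open import Data.Fin as Fin using (Fin; toℕ; fromℕ; inject₁; inject≤; opposite)
open import Data.Fin.Properties
  using (any?; suc-injective; toℕ-fromℕ; opposite-prop; opposite-involutive; inject≤-injective)
open import Data.Product using (Σ; _×_; _,_; proj₁; proj₂)
open import Data.Sum using (_⊎_; inj₁; inj₂)
open import Data.Empty using (⊥; ⊥-elim)
open import Relation.Nullary using (¬_; Dec; yes; no)
open import Relation.Nullary.Decidable using (_×-dec_)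
open import Relation.Binary.Definitions using (DecidableEquality)
open import Relation.Binary.PropositionalEquality
open import Function using (_∘_)
open import Function.Definitions using (Injective)
open import Data.List using (List; filter; length; lookup; allFin)
open import Data.List.Relation.Unary.All as All using (All)
open import Data.List.Relation.Unary.AllPairs using (_∷_)
open import Data.List.Relation.Unary.Any using (index)
open import Data.List.Relation.Unary.All.Properties using (all-filter)
open import Data.List.Relation.Unary.Unique.Propositional using (Unique)
open import Data.List.Relation.Unary.Unique.Propositional.Properties using (filter⁺; allFin⁺)
open import Data.List.Membership.Propositional using (_∈_)
open import Data.List.Membership.Propositional.Properties using (∈-filter⁺; ∈-allFin; ∈-lookup)
import Data.List.Membership.Setoid.Properties as Membership

Unique⇒lookup-injective : ∀ {A : Set} {xs : List A} → Unique xs → Injective _≡_ _≡_ (lookup xs)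
Unique⇒lookup-injective (_ ∷ _)    {Fin.zero}  {Fin.zero}  _  = refl
Unique⇒lookup-injective (x∉ ∷ _)   {Fin.zero}  {Fin.suc j} eq = ⊥-elim (All.lookup x∉ (∈-lookup j) eq)
Unique⇒lookup-injective (x∉ ∷ _)   {Fin.suc i} {Fin.zero}  eq = ⊥-elim (All.lookup x∉ (∈-lookup i) (sym eq))
Unique⇒lookup-injective (_ ∷ uniq) {Fin.suc i} {Fin.suc j} eq = cong Fin.suc (Unique⇒lookup-injective uniq eq)

opposite-inject₁ : ∀ {n} (i : Fin n) → opposite (inject₁ i) ≡ Fin.suc (opposite i)
opposite-inject₁ {suc n} Fin.zero    = refl
opposite-inject₁ {suc n} (Fin.suc i) = cong inject₁ (opposite-inject₁ i)

opposite-fromℕ : ∀ n → opposite (fromℕ n) ≡ Fin.zero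
opposite-fromℕ ℕ.zero    = refl
opposite-fromℕ (suc n)   = cong inject₁ (opposite-fromℕ n)

opposite-injective : ∀ {n} → Injective _≡_ _≡_ (opposite {n})
opposite-injective {_} {i} {j} eq =
  trans (sym (opposite-involutive i)) (trans (cong opposite eq) (opposite-involutive j))

module Colouring {A : Set} {m d : ℕ} (R : A → Fin m → Set) (R? : ∀ a j → Dec (R a j))
  (sparse : ∀ a (f : Fin (suc d) → Fin m) → Injective _≡_ _≡_ f → (∀ i → R a (f i)) → ⊥)
  where

  related : A → List (Fin m)
  related a = filter (R? a) (allFin m)

  ∈-related : ∀ {a j} → R a j → j ∈ related a
  ∈-related {a} {j} = ∈-filter⁺ (R? a) (∈-allFin j)

  length-related≤ : ∀ a → length (related a) ≤ d
  length-related≤ a with d <? length (related a)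
  ... | no d≮length = ≮⇒≥ d≮length
  ... | yes d<length = ⊥-elim (sparse a choose choose-injective (λ i → All.lookup all-related (∈-lookup _)))
    where
    choose : Fin (suc d) → Fin m
    choose i = lookup (related a) (inject≤ i d<length)
    choose-injective : Injective _≡_ _≡_ choose
    choose-injective eq = inject≤-injective d<length d<length _ _
      (Unique⇒lookup-injective (filter⁺ (R? a) (allFin⁺ m)) eq)
    all-related : All (R a) (related a)
    all-related = all-filter (R? a) (allFin m)

  colour : ∀ a j → R a j → Fin d
  colour a j r = inject≤ (index (∈-related r)) (length-related≤ a)

  colour-injective : ∀ {a j j'} (r : R a j) (r' : R a j') → colour a j r ≡ colour a j' r' → j ≡ j'
  colour-injective {a} r r' eq = Membership.index-injective (setoid _) (∈-related r) (∈-related r')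
    (inject≤-injective (length-related≤ a) (length-related≤ a) _ _ eq)

module _ {V : Set} {G : Graph V} where

  Joins : Path G → V → V → Set
  Joins p u v = (start p ≡ u × end p ≡ v) ⊎ (start p ≡ v × end p ≡ u)

  Inner : (p : Path G) → Fin (suc (len p)) → Set
  Inner p i = 0 < toℕ i × toℕ i < len p

  inner? : (p : Path G) (i : Fin (suc (len p))) → Dec (Inner p i)
  inner? p i = (0 <? toℕ i) ×-dec (toℕ i <? len p)

  Internal? : DecidableEquality V → (p : Path G) (v : V) → Dec (Internal p v)
  Internal? _≟_ p v = any? λ i → (0 <? toℕ i) ×-dec ((toℕ i <? len p) ×-dec (verts p i ≟ v))

  ¬Inner-start : (p : Path G) → ¬ Inner p Fin.zero
  ¬Inner-start p (() , _)

  ¬Inner-end : (p : Path G) → ¬ Inner p (fromℕ (len p))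
  ¬Inner-end p (_ , end<len) = <-irrefl (toℕ-fromℕ (len p)) end<len

  reverse : Path G → Path G
  reverse p = record
    { len      = len p
    ; verts    = verts p ∘ opposite
    ; distinct = opposite-injective ∘ distinct p
    ; adjacent = λ i → subst (λ j → E G (verts p j) (verts p (inject₁ (opposite i)))) (sym (opposite-inject₁ i))
                            (Esym G (adjacent p (opposite i)))
    }

  reverse-end : (p : Path G) → end (reverse p) ≡ start p
  reverse-end p = cong (verts p) (opposite-fromℕ (len p))

  Internal-reverse : ∀ p {v} → Internal (reverse p) v → Internal p v
  Internal-reverse p (i , 0<i , i<len , eq) = opposite i , 0<i' , i'<len , eq
    where
    i'≡ : toℕ (opposite i) ≡ len p ∸ toℕ i
    i'≡ = opposite-prop i
    0<i' : 0 < toℕ (opposite i)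
    0<i' = subst (0 <_) (sym i'≡) (m<n⇒0<n∸m i<len)
    i'<len : toℕ (opposite i) < len p
    i'<len = subst (_< len p) (sym i'≡) (∸-monoʳ-< {len p} {toℕ i} {0} 0<i (<⇒≤ i<len))

  edgePath : ∀ {u v} → E G u v → Path G
  edgePath {u} {v} e = record
    { len      = 1
    ; verts    = ends
    ; distinct = ends-injective
    ; adjacent = λ { Fin.zero → e }
    }
    where
    ends : Fin 2 → V
    ends Fin.zero = u
    ends (Fin.suc Fin.zero) = v
    ends-injective : Injective _≡_ _≡_ ends
    ends-injective {Fin.zero}           {Fin.zero}           _  = refl
    ends-injective {Fin.zero}           {Fin.suc Fin.zero}   eq = ⊥-elim (Eirrefl G (subst (λ x → E G x v) eq e))
    ends-injective {Fin.suc Fin.zero}   {Fin.zero}           eq = ⊥-elim (Eirrefl G (subst (λ x → E G x v) (sym eq) e))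
    ends-injective {Fin.suc Fin.zero}   {Fin.suc Fin.zero}   _  = refl

  ¬Inner-edgePath : ∀ {u v} (e : E G u v) i → ¬ Inner (edgePath e) i
  ¬Inner-edgePath e Fin.zero           (() , _)
  ¬Inner-edgePath e (Fin.suc Fin.zero) (_ , s≤s ())

joins-unique : ∀ {n} {G : Graph (Fin n)} {p : Path G} {u v u' v'} →
  Joins p u v → Joins p u' v' → toℕ u < toℕ v → toℕ u' < toℕ v' → u ≡ u' × v ≡ v'
joins-unique (inj₁ (refl , refl)) (inj₁ (refl , refl)) _  _   = refl , refl
joins-unique (inj₂ (refl , refl)) (inj₂ (refl , refl)) _  _   = refl , refl
joins-unique (inj₁ (refl , refl)) (inj₂ (refl , refl)) lt lt' = ⊥-elim (<-asym lt lt')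
joins-unique (inj₂ (refl , refl)) (inj₁ (refl , refl)) lt lt' = ⊥-elim (<-asym lt lt')

module _ {V W : Set} {G : Graph V} {B : Graph W} where

  liftPath : (p : Path G) → (Fin (suc (len p)) → W) → Path (lex G B)
  liftPath p tag = record
    { len      = len p
    ; verts    = λ i → verts p i , tag i
    ; distinct = λ eq → distinct p (cong proj₁ eq)
    ; adjacent = λ i → inj₁ (adjacent p i)
    }

  Internal-liftPath : ∀ p tag {z} → Internal (liftPath p tag) z →
    Σ (Fin (suc (len p))) λ i → Inner p i × z ≡ (verts p i , tag i)
  Internal-liftPath p tag (i , 0<i , i<len , refl) = i , (0<i , i<len) , refl

module ShortcutRouting {n : ℕ} (G : Graph (Fin n)) (d : ℕ) {m : ℕ} (P : Fin m → Path G)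
  (sparse : ∀ w (f : Fin (suc d) → Fin m) → Injective _≡_ _≡_ f → (∀ i → Internal (P (f i)) w) → ⊥)
  where

  open Colouring (λ w j → Internal (P j) w) (λ w j → Internal? Fin._≟_ (P j) w) sparse

  X : Graph (Fin n × Fin (suc d))
  X = lex G (edgeless (Fin (suc d)))

  branch : Fin n → Fin n × Fin (suc d)
  branch v = v , Fin.zero

  tag : (j : Fin m) → Fin (suc (len (P j))) → Fin (suc d)
  tag j i with inner? (P j) i
  ... | yes (0<i , i<len) = Fin.suc (colour _ j (i , 0<i , i<len , refl))
  ... | no _              = Fin.zero

  tag-outer : ∀ {j i} → ¬ Inner (P j) i → tag j i ≡ Fin.zero
  tag-outer {j} {i} outer with inner? (P j) i
  ... | yes inner = ⊥-elim (outer inner)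
  ... | no _      = refl

  tag-inner : ∀ {j i} → Inner (P j) i →
    Σ (Internal (P j) (verts (P j) i)) λ r → tag j i ≡ Fin.suc (colour _ j r)
  tag-inner {j} {i} inner with inner? (P j) i
  ... | yes (0<i , i<len) = (i , 0<i , i<len , refl) , refl
  ... | no outer          = ⊥-elim (outer inner)

  shortcut : Fin m → Path X
  shortcut j = liftPath (P j) (tag j)

  shortcut-start : ∀ j → start (shortcut j) ≡ branch (start (P j))
  shortcut-start j = cong (start (P j) ,_) (tag-outer (¬Inner-start (P j)))

  shortcut-end : ∀ j → end (shortcut j) ≡ branch (end (P j))
  shortcut-end j = cong (end (P j) ,_) (tag-outer (¬Inner-end (P j)))

  Carries : Fin m → Fin n × Fin (suc d) → Set
  Carries j z = Σ (Fin n) λ w → Σ (Internal (P j) w) λ r → z ≡ (w , Fin.suc (colour w j r))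

  Internal-shortcut : ∀ {j z} → Internal (shortcut j) z → Carries j z
  Internal-shortcut {j} int with Internal-liftPath {B = edgeless _} (P j) (tag j) int
  ... | i , inner , refl =
    let r , tag≡ = tag-inner inner in verts (P j) i , r , cong (verts (P j) i ,_) tag≡

  carrier-unique : ∀ {j j' z} → Carries j z → Carries j' z → j ≡ j'
  carrier-unique (w , r , refl) (w' , r' , eq) with cong proj₁ eq
  ... | refl = colour-injective r r' (suc-injective (cong proj₂ eq))

  ¬Carries-branch : ∀ {j} v → ¬ Carries j (branch v)
  ¬Carries-branch v (_ , _ , ())

  route : ∀ u v → E (shortcutGraph G P) u v → Path X
  route u v (inj₁ e)                  = liftPath (edgePath e) (λ _ → Fin.zero)
  route u v (inj₂ (_ , j , inj₁ _)) = shortcut j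
  route u v (inj₂ (_ , j , inj₂ _)) = reverse (shortcut j)

  route-start : ∀ u v e → start (route u v e) ≡ branch u
  route-start u v (inj₁ e)                         = refl
  route-start u v (inj₂ (_ , j , inj₁ (refl , _))) = shortcut-start j
  route-start u v (inj₂ (_ , j , inj₂ (_ , refl))) = shortcut-end j

  route-end : ∀ u v e → end (route u v e) ≡ branch v
  route-end u v (inj₁ e)                         = refl
  route-end u v (inj₂ (_ , j , inj₁ (_ , refl))) = shortcut-end j
  route-end u v (inj₂ (_ , j , inj₂ (refl , _))) = trans (reverse-end (shortcut j)) (shortcut-start j)

  route-length : ∀ {k} → (∀ j → len (P j) ≤ suc k) → ∀ u v e → len (route u v e) ≤ suc k
  route-length short u v (inj₁ e)                = s≤s z≤n
  route-length short u v (inj₂ (_ , j , inj₁ _)) = short j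
  route-length short u v (inj₂ (_ , j , inj₂ _)) = short j

  Internal-route : ∀ u v e {z} → Internal (route u v e) z →
    Σ (Fin m) λ j → Carries j z × Joins (P j) u v
  Internal-route u v (inj₁ e) int with Internal-liftPath {B = edgeless _} (edgePath {G = G} e) (λ _ → Fin.zero) int
  ... | i , inner , _ = ⊥-elim (¬Inner-edgePath {G = G} e i inner)
  Internal-route u v (inj₂ (_ , j , joins@(inj₁ _))) int =
    j , Internal-shortcut int , joins
  Internal-route u v (inj₂ (_ , j , joins@(inj₂ _))) int =
    j , Internal-shortcut (Internal-reverse (shortcut j) int) , joins

  branch-∉-route : ∀ u v e w z → Internal (route u v e) z → branch w ≢ z
  branch-∉-route u v e w z int refl = ¬Carries-branch w (proj₁ (proj₂ (Internal-route u v e int)))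

  routes-disjoint : ∀ u v (lt : toℕ u < toℕ v) e u' v' (lt' : toℕ u' < toℕ v') e' →
    ¬ (u ≡ u' × v ≡ v') → ∀ z → Internal (route u v e) z → ¬ Internal (route u' v' e') z
  routes-disjoint u v lt e u' v' lt' e' different z int int'
    with Internal-route u v e int | Internal-route u' v' e' int'
  ... | j , carries , joins | j' , carries' , joins' with carrier-unique carries carries'
  ... | refl = different (joins-unique {p = P j} joins joins' lt lt')

lemma6 : (k d : ℕ) → 1 ≤ k → (n : ℕ) (G : Graph (Fin n)) (m : ℕ) (P : Fin m → Path G) →
    IsShortcutSystem G k d P →
    ShallowTopMinor2s (k ∸ 1) (shortcutGraph G P) (lex G (edgeless (Fin (suc d))))
lemma6 (suc k) d _ n G m P (short , sparse) =
  branch , cong proj₁ , (λ u v _ → route u v) ,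
  (λ u v _ e → route-start u v e , route-end u v e , route-length short u v e , branch-∉-route u v e) ,
  routes-disjoint
  where open ShortcutRouting G d P sparse
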